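{- Let $h$ be a history of the canonical pseudo-model $M^c$ of $\mathbf{SC}$, and let $\Gamma=\mathrm{last}(h)$. Then, for every agent $a\in A$, $a\in\mathrm{live}(h)$ (computed in the unravelling $U(M^c)$) iff $\mathsf{alive}(a)\in\Gamma$.
   Context: Fix a finite set $A$ of agents and a countable set $\mathsf{AP}$. $\mathcal L_D$: $\varphi::=p\mid\neg\varphi\mid\varphi\wedge\varphi\mid D_B\varphi$, $\emptyset\ne B\subseteq A$; $K_a\varphi:=D_{\{a\}}\varphi$, $\mathsf{dead}(a):=K_a\bot$, $\mathsf{alive}(a):=\neg\mathsf{dead}(a)$, $\mathsf{dead}(B):=\bigwedge_{a\in B}\mathsf{dead}(a)$, $\mathsf{alive}(B):=\neg D_B\bot$, $\overline B=A\setminus B$. $\mathbf{SC}$: propositional tautologies, modus ponens, necessitation, and for non-empty $B,B'$: $D_B(\varphi\Rightarrow\psi)\Rightarrow(D_B\varphi\Rightarrow D_B\psi)$; $\varphi\Rightarrow D_B\neg D_B\neg\varphi$; $D_B\varphi\Rightarrow D_BD_B\varphi$; $D_B\varphi\Rightarrow D_{B'}\varphi$ ($B\subseteq B'$); $\mathsf{alive}(B)\wedge\mathsf{alive}(B')\Rightarrow\mathsf{alive}(B\cup B')$; $\bigvee_{a\in A}\mathsf{alive}(a)$; $\mathsf{alive}(B)\wedge\mathsf{dead}(\overline B)\wedge\varphi\Rightarrow D_B(\mathsf{dead}(\overline B)\Rightarrow\varphi)$. The canonical pseudo-model $M^c$: worlds are maximal $\mathbf{SC}$-consistent sets of formulas;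 $\Gamma\sim^c_B\Delta$ iff $D_B\varphi\in\Gamma$ implies $\varphi\in\Delta$ for all $\varphi$; $L^c(\Gamma)=\Gamma\cap\mathsf{AP}$. A history of $M^c$ is $h=(\Gamma_0,B_1,\Gamma_1,\dots,B_k,\Gamma_k)$, $k\ge0$, $B_i\subseteq A$, $\Gamma_{i-1}\sim^c_{B_i}\Gamma_i$; $\mathrm{last}(h)=\Gamma_k$; $h\to_ah'$ iff $h'=(h,B_{k+1},\Gamma_{k+1})$ with $a\in B_{k+1}$. The unravelling $U(M^c)$ has histories as worlds and $\sim^u_a$ the transitive closure of $\to_a\cup\leftarrow_a$; $\mathrm{live}(h)=\{a: h\sim^u_a h\}$. -}

module Defs where

open import Data.Nat using (ℕ; zero)
open import Data.Bool using (Bool; true; false; not; _∧_)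
open import Data.Fin using (Fin)
open import Data.Fin.Subset using (Subset; _∈_; _⊆_; _∪_; ∁; ⁅_⁆; Nonempty)
open import Data.Fin.Subset.Properties using (x∈⁅x⁆; p⊆p∪q; _∈?_)
open import Data.List using (List; []; _∷_; map)
open import Data.List.Base using (allFin)
open import Data.List.Membership.Propositional renaming (_∈_ to _∈ˡ_)
open import Data.List.Relation.Unary.All using (All)
open import Data.Product using (Σ; _×_; _,_; proj₁; proj₂)
open import Data.Sum using (_⊎_)
open import Data.Empty using (⊥)
open import Relation.Nullary using (¬_; yes; no)
open import Relation.Binary.PropositionalEquality using (_≡_)
open import Relation.Binary.Construct.Closure.Transitive using (TransClosure)
open import Relation.Binary.Construct.Closure.Symmetric using (SymClosure)

-- Agents: A = Fin n.  Atomic propositions: AP = ℕ.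
-- The language L_D.  D_B is only formed for non-empty B; the
-- non-emptiness proof is irrelevant, so D B p φ ≡ D B q φ.

data Form (n : ℕ) : Set where
  var  : ℕ → Form n
  ¬'_  : Form n → Form n
  _∧'_ : Form n → Form n → Form n
  D    : (B : Subset n) → .(Nonempty B) → Form n → Form n

infixr 6 _∧'_

module _ {n : ℕ} where

  ⊥' : Form n
  ⊥' = var zero ∧' ¬' var zero

  ⊤' : Form n
  ⊤' = ¬' ⊥'

  infixr 4 _⇒'_
  _⇒'_ : Form n → Form n → Form n
  φ ⇒' ψ = ¬' (φ ∧' ¬' ψ)

  _∨'_ : Form n → Form n → Form n
  φ ∨' ψ = ¬' (¬' φ ∧' ¬' ψ)

  ⋀ : List (Form n) → Form n
  ⋀ []       = ⊤'
  ⋀ (φ ∷ φs) = φ ∧' ⋀ φs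

  ⋁ : List (Form n) → Form n
  ⋁ []       = ⊥'
  ⋁ (φ ∷ φs) = φ ∨' ⋁ φs

  K : Fin n → Form n → Form n
  K a = D ⁅ a ⁆ (a , x∈⁅x⁆ a)

  dead : Fin n → Form n
  dead a = K a ⊥'

  alive : Fin n → Form n
  alive a = ¬' dead a

  deadConj : Subset n → List (Fin n) → List (Form n)
  deadConj B []       = []
  deadConj B (a ∷ as) with a ∈? B
  ... | yes _ = dead a ∷ deadConj B as
  ... | no  _ = deadConj B as

  deadS : Subset n → Form n
  deadS B = ⋀ (deadConj B (allFin n))

  aliveS : (B : Subset n) → .(Nonempty B) → Form n
  aliveS B ne = ¬' D B ne ⊥'

  eval : (Form n → Bool) → Form n → Bool
  eval v (var p)    = v (var p)
  eval v (¬' φ)     = not (eval v φ)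
  eval v (φ ∧' ψ)   = eval v φ ∧ eval v ψ
  eval v (D B ne φ) = v (D B ne φ)

  Tautology : Form n → Set
  Tautology φ = (v : Form n → Bool) → eval v φ ≡ true

  ne-⊆ : {B B' : Subset n} → B ⊆ B' → Nonempty B → Nonempty B'
  ne-⊆ sub (x , x∈B) = x , sub x∈B

  ne-∪ : (B B' : Subset n) → Nonempty B → Nonempty (B ∪ B')
  ne-∪ B B' = ne-⊆ (p⊆p∪q B')

  data ⊢_ : Form n → Set where
    taut  : ∀ {φ} → Tautology φ → ⊢ φ
    mp    : ∀ {φ ψ} → ⊢ (φ ⇒' ψ) → ⊢ φ → ⊢ ψ
    nec   : ∀ {φ} B (ne : Nonempty B) → ⊢ φ → ⊢ D B ne φ
    axK   : ∀ B (ne : Nonempty B) φ ψ →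
            ⊢ (D B ne (φ ⇒' ψ) ⇒' (D B ne φ ⇒' D B ne ψ))
    axB   : ∀ B (ne : Nonempty B) φ →
            ⊢ (φ ⇒' D B ne (¬' D B ne (¬' φ)))
    ax4   : ∀ B (ne : Nonempty B) φ →
            ⊢ (D B ne φ ⇒' D B ne (D B ne φ))
    axMon : ∀ B B' (ne : Nonempty B) (sub : B ⊆ B') φ →
            ⊢ (D B ne φ ⇒' D B' (ne-⊆ sub ne) φ)
    axUn  : ∀ B B' (ne : Nonempty B) (ne' : Nonempty B') →
            ⊢ ((aliveS B ne ∧' aliveS B' ne') ⇒' aliveS (B ∪ B') (ne-∪ B B' ne))
    axAl  : ⊢ ⋁ (map alive (allFin n))
    axSC  : ∀ B (ne : Nonempty B) φ →
            ⊢ ((aliveS B ne ∧' deadS (∁ B) ∧' φ) ⇒' D B ne (deadS (∁ B) ⇒' φ))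

  FSet : Set₁
  FSet = Form n → Set

  Consistent : FSet → Set
  Consistent Γ = ¬ (Σ (List (Form n)) λ L → All Γ L × (⊢ (⋀ L ⇒' ⊥')))

  MaxCons : FSet → Set
  MaxCons Γ = Consistent Γ ×
              ((φ : Form n) → Consistent (λ ψ → Γ ψ ⊎ ψ ≡ φ) → Γ φ)

  record MCS : Set₁ where
    constructor mcs
    field
      set   : FSet
      isMCS : MaxCons set
  open MCS public

  CanRel : (B : Subset n) → Nonempty B → MCS → MCS → Set
  CanRel B ne Γ Δ = (φ : Form n) → set Γ (D B ne φ) → set Δ φ

  mutual
    data History : Set₁ where
      start : MCS → History
      step  : (h : History) (B : Subset n) (ne : Nonempty B) (Δ : MCS) →
              CanRel B ne (last h) Δ → History

    last : History → MCS
    last (start Γ)          = Γ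
    last (step h B ne Δ r)  = Δ

  data Arrow (a : Fin n) : History → History → Set₁ where
    ext : ∀ h B ne Δ r → a ∈ B → Arrow a h (step h B ne Δ r)

  _~u[_]_ : History → Fin n → History → Set₁
  h ~u[ a ] h' = TransClosure (SymClosure (Arrow a)) h h'

  _∈live_ : Fin n → History → Set₁
  a ∈live h = h ~u[ a ] h

{-# OPTIONS --safe #-}
module Submission where

-- An a-step of the unravelling, in either direction, is a canonical B-step with a ∈ B.
-- A canonical B-step can only leave a world containing alive(B) (otherwise ⊥ would lie
-- in its target), the canonical relation is symmetric by axiom B, and alive(B) implies
-- alive(a) for a ∈ B; so a ∈ live(h) forces alive(a) ∈ last(h). Conversely, if
-- alive(a) ∈ last(h) then last(h) is a canonical {a}-successor of itself, and the
-- history h →ₐ (h, {a}, last h) ←ₐ h is an a-loop at h.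

open import Defs
open import Data.Bool using (Bool; true; false; not; _∧_; T)
open import Data.Bool.Properties using (∧-inverseʳ; T-≡; T-∧)
open import Data.Fin using (Fin)
import Data.Fin as Fin
open import Data.Fin.Subset using (Subset; _∈_; _⊆_; ⁅_⁆; Nonempty)
open import Data.Fin.Subset.Properties using (x∈⁅x⁆; x∈⁅y⁆⇒x≡y)
open import Data.List using (List; []; _∷_; _++_)
open import Data.List.Relation.Unary.All using (All; []; _∷_)
open import Data.List.Relation.Unary.All.Properties using (++⁺)
open import Data.Nat using (ℕ; zero; suc)
open import Data.Product using (Σ; _×_; _,_; proj₁; proj₂)
open import Data.Sum using (_⊎_; inj₁; inj₂)
open import Data.Vec using (Vec; []; _∷_; lookup; map)
open import Data.Vec.Properties using (lookup-map)
open import Function.Bundles using (_⇔_; mk⇔; Equivalence)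
open import Relation.Binary.Construct.Closure.Symmetric using (SymClosure; fwd; bwd)
open import Relation.Binary.Construct.Closure.Transitive using ([_]; _∷_)
open import Relation.Binary.PropositionalEquality using (_≡_; refl; cong; cong₂; subst; sym)
open import Relation.Nullary using (¬_)

-- Propositional steps are discharged by truth tables over formula schemas.
data Schema (k : ℕ) : Set where
  atomₛ : Fin k → Schema k
  ⊥ₛ    : Schema k
  ¬ₛ_   : Schema k → Schema k
  _∧ₛ_  : Schema k → Schema k → Schema k

infixr 6 _∧ₛ_

module _ {k : ℕ} where

  infixr 4 _⇒ₛ_

  ⊤ₛ : Schema k
  ⊤ₛ = ¬ₛ ⊥ₛ

  _⇒ₛ_ : Schema k → Schema k → Schema k
  P ⇒ₛ Q = ¬ₛ (P ∧ₛ ¬ₛ Q)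

  ⟦_⟧ₛ : Schema k → Vec Bool k → Bool
  ⟦ atomₛ i ⟧ₛ ρ = lookup ρ i
  ⟦ ⊥ₛ ⟧ₛ     ρ = false
  ⟦ ¬ₛ P ⟧ₛ   ρ = not (⟦ P ⟧ₛ ρ)
  ⟦ P ∧ₛ Q ⟧ₛ ρ = ⟦ P ⟧ₛ ρ ∧ ⟦ Q ⟧ₛ ρ

  _[_]ₛ : ∀ {n} → Schema k → Vec (Form n) k → Form n
  atomₛ i [ σ ]ₛ = lookup σ i
  ⊥ₛ      [ σ ]ₛ = ⊥'
  (¬ₛ P)   [ σ ]ₛ = ¬' (P [ σ ]ₛ)
  (P ∧ₛ Q) [ σ ]ₛ = P [ σ ]ₛ ∧' Q [ σ ]ₛ

  eval-[]ₛ : ∀ {n} (v : Form n → Bool) (P : Schema k) (σ : Vec (Form n) k) →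
             eval v (P [ σ ]ₛ) ≡ ⟦ P ⟧ₛ (map (eval v) σ)
  eval-[]ₛ v (atomₛ i) σ = sym (lookup-map i (eval v) σ)
  eval-[]ₛ v ⊥ₛ       σ = ∧-inverseʳ (v (var 0))
  eval-[]ₛ v (¬ₛ P)   σ = cong not (eval-[]ₛ v P σ)
  eval-[]ₛ v (P ∧ₛ Q) σ = cong₂ _∧_ (eval-[]ₛ v P σ) (eval-[]ₛ v Q σ)

v₀ : ∀ {k} → Schema (suc k)
v₀ = atomₛ Fin.zero

v₁ : ∀ {k} → Schema (suc (suc k))
v₁ = atomₛ (Fin.suc Fin.zero)

v₂ : ∀ {k} → Schema (suc (suc (suc k)))
v₂ = atomₛ (Fin.suc (Fin.suc Fin.zero))

v₃ : ∀ {k} → Schema (suc (suc (suc (suc k))))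
v₃ = atomₛ (Fin.suc (Fin.suc (Fin.suc Fin.zero)))

everyRow : (k : ℕ) → (Vec Bool k → Bool) → Bool
everyRow zero    f = f []
everyRow (suc k) f = everyRow k (λ ρ → f (true ∷ ρ)) ∧ everyRow k (λ ρ → f (false ∷ ρ))

everyRow-sound : ∀ k (f : Vec Bool k → Bool) → T (everyRow k f) → ∀ ρ → T (f ρ)
everyRow-sound zero    f holds []          = holds
everyRow-sound (suc k) f holds (true ∷ ρ)  =
  everyRow-sound k _ (proj₁ (Equivalence.to T-∧ holds)) ρ
everyRow-sound (suc k) f holds (false ∷ ρ) =
  everyRow-sound k _ (proj₂ (Equivalence.to T-∧ holds)) ρ

tautology : ∀ {n k} (P : Schema k) (σ : Vec (Form n) k) →
            {T (everyRow k ⟦ P ⟧ₛ)} → ⊢ (P [ σ ]ₛ)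
tautology {k = k} P σ {valid} = taut λ v →
  subst (_≡ true) (sym (eval-[]ₛ v P σ))
        (Equivalence.to T-≡ (everyRow-sound k ⟦ P ⟧ₛ valid (map (eval v) σ)))

module _ {n : ℕ} where

  infix 3 _⊩_

  _⊩_ : FSet {n} → Form n → Set
  Γ ⊩ φ = Σ (List (Form n)) λ L → All Γ L × ⊢ (⋀ L ⇒' φ)

  mp₂ : {φ ψ χ : Form n} → ⊢ (φ ⇒' ψ ⇒' χ) → ⊢ φ → ⊢ ψ → ⊢ χ
  mp₂ p q r = mp (mp p q) r

  ⇒-trans : {φ ψ χ : Form n} → ⊢ (φ ⇒' ψ) → ⊢ (ψ ⇒' χ) → ⊢ (φ ⇒' χ)
  ⇒-trans {φ} {ψ} {χ} =
    mp₂ (tautology ((v₀ ⇒ₛ v₁) ⇒ₛ (v₁ ⇒ₛ v₂) ⇒ₛ v₀ ⇒ₛ v₂) (φ ∷ ψ ∷ χ ∷ []))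

  contraposition : {φ ψ : Form n} → ⊢ (φ ⇒' ψ) → ⊢ (¬' ψ ⇒' ¬' φ)
  contraposition {φ} {ψ} =
    mp (tautology ((v₀ ⇒ₛ v₁) ⇒ₛ ¬ₛ v₁ ⇒ₛ ¬ₛ v₀) (φ ∷ ψ ∷ []))

  ⋀-++ : (L M : List (Form n)) → ⊢ (⋀ (L ++ M) ⇒' ⋀ L ∧' ⋀ M)
  ⋀-++ []      M = tautology (v₀ ⇒ₛ ⊤ₛ ∧ₛ v₀) (⋀ M ∷ [])
  ⋀-++ (χ ∷ L) M = mp (tautology ((v₀ ⇒ₛ v₁ ∧ₛ v₂) ⇒ₛ v₃ ∧ₛ v₀ ⇒ₛ (v₃ ∧ₛ v₁) ∧ₛ v₂)
                                  (⋀ (L ++ M) ∷ ⋀ L ∷ ⋀ M ∷ χ ∷ []))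
                      (⋀-++ L M)

  module _ {Γ : FSet {n}} where

    ⊩-mp : {φ ψ : Form n} → Γ ⊩ φ → ⊢ (φ ⇒' ψ) → Γ ⊩ ψ
    ⊩-mp (L , L⊆Γ , p) q = L , L⊆Γ , ⇒-trans p q

    ⊩-theorem : {φ : Form n} → ⊢ φ → Γ ⊩ φ
    ⊩-theorem {φ} p = [] , [] , mp (tautology (v₀ ⇒ₛ ⊤ₛ ⇒ₛ v₀) (φ ∷ [])) p

    ⊩-member : {φ : Form n} → Γ φ → Γ ⊩ φ
    ⊩-member {φ} φ∈Γ = φ ∷ [] , φ∈Γ ∷ [] , tautology (v₀ ∧ₛ ⊤ₛ ⇒ₛ v₀) (φ ∷ [])

    ⊩-∧ : {φ ψ : Form n} → Γ ⊩ φ → Γ ⊩ ψ → Γ ⊩ φ ∧' ψ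
    ⊩-∧ {φ} {ψ} (L , L⊆Γ , p) (M , M⊆Γ , q) =
      L ++ M , ++⁺ L⊆Γ M⊆Γ ,
      ⇒-trans (⋀-++ L M)
        (mp₂ (tautology ((v₀ ⇒ₛ v₂) ⇒ₛ (v₁ ⇒ₛ v₃) ⇒ₛ v₀ ∧ₛ v₁ ⇒ₛ v₂ ∧ₛ v₃)
                        (⋀ L ∷ ⋀ M ∷ φ ∷ ψ ∷ []))
             p q)

    ⊩-deduction : {φ ψ : Form n} → (λ χ → Γ χ ⊎ χ ≡ φ) ⊩ ψ → Γ ⊩ (φ ⇒' ψ)
    ⊩-deduction {φ} {ψ} (L , L⊆Γ,φ , p) =
      ⊩-mp (⇒-⋀ L⊆Γ,φ)
           (mp (tautology ((v₀ ⇒ₛ v₁) ⇒ₛ (v₂ ⇒ₛ v₀) ⇒ₛ v₂ ⇒ₛ v₁) (⋀ L ∷ ψ ∷ φ ∷ [])) p)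
      where
      ⇒-⋀ : {M : List (Form n)} → All (λ χ → Γ χ ⊎ χ ≡ φ) M → Γ ⊩ (φ ⇒' ⋀ M)
      ⇒-⋀ [] = ⊩-theorem (tautology (v₀ ⇒ₛ ⊤ₛ) (φ ∷ []))
      ⇒-⋀ {χ ∷ M} (inj₁ χ∈Γ ∷ M⊆Γ,φ) =
        ⊩-mp (⊩-∧ (⊩-member χ∈Γ) (⇒-⋀ M⊆Γ,φ))
             (tautology (v₀ ∧ₛ (v₁ ⇒ₛ v₂) ⇒ₛ v₁ ⇒ₛ v₀ ∧ₛ v₂) (χ ∷ φ ∷ ⋀ M ∷ []))
      ⇒-⋀ {χ ∷ M} (inj₂ refl ∷ M⊆Γ,φ) =
        ⊩-mp (⇒-⋀ M⊆Γ,φ) (tautology ((v₀ ⇒ₛ v₁) ⇒ₛ v₀ ⇒ₛ v₀ ∧ₛ v₁) (φ ∷ ⋀ M ∷ []))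

  module _ (Γ : MCS {n}) where

    ∈-if-irrefutable : {φ : Form n} → ¬ (set Γ ⊩ (φ ⇒' ⊥')) → set Γ φ
    ∈-if-irrefutable {φ} irrefutable =
      proj₂ (isMCS Γ) φ λ inconsistent → irrefutable (⊩-deduction inconsistent)

    ⊩-refutation : {φ : Form n} → set Γ ⊩ φ → ¬ (set Γ ⊩ (φ ⇒' ⊥'))
    ⊩-refutation {φ} Γ⊩φ refutation =
      proj₁ (isMCS Γ) (⊩-mp (⊩-∧ Γ⊩φ refutation) (tautology (v₀ ∧ₛ (v₀ ⇒ₛ ⊥ₛ) ⇒ₛ ⊥ₛ) (φ ∷ [])))

    ⊩⇒∈ : {φ : Form n} → set Γ ⊩ φ → set Γ φ
    ⊩⇒∈ Γ⊩φ = ∈-if-irrefutable (⊩-refutation Γ⊩φ)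

    ∈-stable : {φ : Form n} → ¬ ¬ set Γ φ → set Γ φ
    ∈-stable ¬¬φ∈Γ = ∈-if-irrefutable λ refutation →
      ¬¬φ∈Γ λ φ∈Γ → ⊩-refutation (⊩-member φ∈Γ) refutation

    ∈-mp : {φ ψ : Form n} → set Γ φ → ⊢ (φ ⇒' ψ) → set Γ ψ
    ∈-mp φ∈Γ p = ⊩⇒∈ (⊩-mp (⊩-member φ∈Γ) p)

    ∈-mp₂ : {φ ψ χ : Form n} → set Γ φ → set Γ ψ → ⊢ (φ ⇒' ψ ⇒' χ) → set Γ χ
    ∈-mp₂ {φ} {ψ} {χ} φ∈Γ ψ∈Γ p =
      ⊩⇒∈ (⊩-mp (⊩-∧ (⊩-member φ∈Γ) (⊩-member ψ∈Γ))
                (mp (tautology ((v₀ ⇒ₛ v₁ ⇒ₛ v₂) ⇒ₛ v₀ ∧ₛ v₁ ⇒ₛ v₂) (φ ∷ ψ ∷ χ ∷ [])) p))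

    ⊥∉ : ¬ set Γ ⊥'
    ⊥∉ ⊥∈Γ = proj₁ (isMCS Γ) (⊩-member ⊥∈Γ)

    ¬∈⇒∉ : {φ : Form n} → set Γ (¬' φ) → ¬ set Γ φ
    ¬∈⇒∉ {φ} ¬φ∈Γ φ∈Γ = ⊥∉ (∈-mp₂ φ∈Γ ¬φ∈Γ (tautology (v₀ ⇒ₛ ¬ₛ v₀ ⇒ₛ ⊥ₛ) (φ ∷ [])))

    ∉⇒¬∈ : {φ : Form n} → ¬ set Γ φ → set Γ (¬' φ)
    ∉⇒¬∈ {φ} φ∉Γ = ∈-if-irrefutable λ refutation →
      φ∉Γ (⊩⇒∈ (⊩-mp refutation (tautology ((¬ₛ v₀ ⇒ₛ ⊥ₛ) ⇒ₛ v₀) (φ ∷ []))))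

  module _ (B : Subset n) (ne : Nonempty B) where

    D-mono : {φ ψ : Form n} → ⊢ (φ ⇒' ψ) → ⊢ (D B ne φ ⇒' D B ne ψ)
    D-mono p = mp (axK B ne _ _) (nec B ne p)

    D-mono₂ : {φ ψ χ : Form n} → ⊢ (φ ⇒' ψ ⇒' χ) → ⊢ (D B ne φ ⇒' D B ne ψ ⇒' D B ne χ)
    D-mono₂ p = ⇒-trans (D-mono p) (axK B ne _ _)

    axB-dual : (φ : Form n) → ⊢ (¬' φ ⇒' D B ne (¬' D B ne φ))
    axB-dual φ =
      ⇒-trans (axB B ne (¬' φ))
              (D-mono (contraposition (D-mono (tautology (v₀ ⇒ₛ ¬ₛ ¬ₛ v₀) (φ ∷ [])))))

    aliveS⇒alive : {a : Fin n} → a ∈ B → ⊢ (aliveS B ne ⇒' alive a)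
    aliveS⇒alive {a} a∈B = contraposition (axMon ⁅ a ⁆ B (a , x∈⁅x⁆ a) ⁅a⁆⊆B ⊥')
      where
      ⁅a⁆⊆B : ⁅ a ⁆ ⊆ B
      ⁅a⁆⊆B x∈⁅a⁆ = subst (_∈ B) (sym (x∈⁅y⁆⇒x≡y a x∈⁅a⁆)) a∈B

    CanRel-sym : (Γ Δ : MCS) → CanRel B ne Γ Δ → CanRel B ne Δ Γ
    CanRel-sym Γ Δ Γ~Δ φ Dφ∈Δ = ∈-stable Γ λ φ∉Γ →
      ¬∈⇒∉ Δ (Γ~Δ _ (∈-mp Γ (∉⇒¬∈ Γ φ∉Γ) (axB-dual φ))) Dφ∈Δ

    -- SC has no axiom T; at worlds containing alive(B) it follows from axioms 4 and B.
    CanRel-refl : (Γ : MCS) → set Γ (aliveS B ne) → CanRel B ne Γ Γ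
    CanRel-refl Γ alive∈Γ φ Dφ∈Γ = ∈-stable Γ λ φ∉Γ →
      ¬∈⇒∉ Γ alive∈Γ
        (∈-mp₂ Γ (∈-mp Γ Dφ∈Γ (ax4 B ne φ)) (∈-mp Γ (∉⇒¬∈ Γ φ∉Γ) (axB-dual φ))
               (D-mono₂ (tautology (v₀ ⇒ₛ ¬ₛ v₀ ⇒ₛ ⊥ₛ) (D B ne φ ∷ []))))

    CanRel-source-alive : (Γ Δ : MCS) → CanRel B ne Γ Δ → set Γ (aliveS B ne)
    CanRel-source-alive Γ Δ Γ~Δ = ∉⇒¬∈ Γ λ D⊥∈Γ → ⊥∉ Δ (Γ~Δ ⊥' D⊥∈Γ)

  module _ {a : Fin n} where

    adjacent⇒alive : {h h' : History} → SymClosure (Arrow a) h h' → set (last h) (alive a)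
    adjacent⇒alive (fwd (ext h B ne Δ Γ~Δ a∈B)) =
      ∈-mp (last h) (CanRel-source-alive B ne (last h) Δ Γ~Δ) (aliveS⇒alive B ne a∈B)
    adjacent⇒alive (bwd (ext h B ne Δ Γ~Δ a∈B)) =
      ∈-mp Δ (CanRel-source-alive B ne Δ (last h) (CanRel-sym B ne (last h) Δ Γ~Δ))
           (aliveS⇒alive B ne a∈B)

    live⇒alive : {h : History} → a ∈live h → set (last h) (alive a)
    live⇒alive [ h~h' ]   = adjacent⇒alive h~h'
    live⇒alive (h~h' ∷ _) = adjacent⇒alive h~h'

    Arrow⇒live : {h h' : History} → Arrow a h h' → a ∈live h
    Arrow⇒live h→h' = fwd h→h' ∷ [ bwd h→h' ]

    alive⇒live : {h : History} → set (last h) (alive a) → a ∈live h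
    alive⇒live {h} alive∈Γ =
      Arrow⇒live (ext h ⁅ a ⁆ a≠∅ (last h) (CanRel-refl ⁅ a ⁆ a≠∅ (last h) alive∈Γ) (x∈⁅x⁆ a))
      where
      a≠∅ : Nonempty ⁅ a ⁆
      a≠∅ = a , x∈⁅x⁆ a

lemma44 : {n : ℕ} (h : History {n}) (a : Fin n) →
    (a ∈live h) ⇔ set (last h) (alive a)
lemma44 h a = mk⇔ live⇒alive alive⇒live
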